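{- Let $m,n\ge 0$. For every $\mathfrak{v}=v_1\cdots v_n\in\mathsf{W}(m,n)$ we have $\mathsf{in}(\mathfrak{v})=\mathsf{top}(\mathfrak{v})+\lvert\mathsf{Supp}(\mathfrak{v})\rvert$.
   Context: An $(m,n)$-word is a word $\mathfrak{w}=w_1w_2\cdots w_n$ of length $n$ over the alphabet $\{0,1,\dots,m+1\}$ such that (MN1) $w_1\neq m+1$, and (MN2) for every $s$ with $1\le s\le m$ and every index $i$, if $w_i=s$ then $w_j\ge s$ for all $j<i$. $\mathsf{W}(m,n)$ is the set of $(m,n)$-words and $\mathbf{W}(m,n)$ is $\mathsf{W}(m,n)$ ordered componentwise. For $\mathfrak{v}\in\mathsf{W}(m,n)$: $\mathsf{in}(\mathfrak{v})$ is the number of elements of $\mathsf{W}(m,n)$ covered by $\mathfrak{v}$ in $\mathbf{W}(m,n)$; $\mathsf{top}(\mathfrak{v})=\lvert\{i\in\{2,\dots,n\}: v_i=m+1\}\rvert$; and $\mathsf{Supp}(\mathfrak{v})=\{v_j: j\in\{1,\dots,n\},\ v_j\in\{1,\dots,m\}\}$ is the set of distinct letters of $\mathfrak{v}$ different from $0$ and $m+1$. -}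

module Defs where

open import Data.Nat using (ℕ; zero; suc; _+_; _≤_; _<_; _≟_)
open import Data.Fin using (Fin; toℕ)
open import Data.Vec using (Vec; []; _∷_; lookup)
open import Data.List using (List; length; filter; upTo; map)
open import Data.List.Membership.Propositional using (_∈_)
open import Data.List.Relation.Unary.Unique.Propositional using (Unique)
open import Data.Product using (Σ; _×_; ∃)
open import Relation.Binary.PropositionalEquality using (_≡_; _≢_)
open import Relation.Nullary using (¬_)
open import Function.Bundles using (_⇔_)
import Data.Vec.Relation.Unary.Any as VAny

record IsWord (m n : ℕ) (w : Vec ℕ n) : Set where
  field
    alphabet : ∀ (i : Fin n) → lookup w i ≤ suc m
    mn1 : ∀ (i : Fin n) → toℕ i ≡ 0 → lookup w i ≢ suc m
    mn2 : ∀ (i j : Fin n) → toℕ j < toℕ i →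
          1 ≤ lookup w i → lookup w i ≤ m → lookup w i ≤ lookup w j

_≤W_ : ∀ {n} → Vec ℕ n → Vec ℕ n → Set
u ≤W v = ∀ i → lookup u i ≤ lookup v i

_<W_ : ∀ {n} → Vec ℕ n → Vec ℕ n → Set
u <W v = (u ≤W v) × (u ≢ v)

Covers : (m n : ℕ) → Vec ℕ n → Vec ℕ n → Set
Covers m n v u =
  IsWord m n u × IsWord m n v × (u <W v) ×
  ¬ (Σ (Vec ℕ n) λ w → IsWord m n w × (u <W w) × (w <W v))

-- "in(v) = k": the set of elements of W(m,n) covered by v has exactly k
-- elements, i.e. it is enumerated by a duplicate-free list of length k.
HasIn : (m n : ℕ) → Vec ℕ n → ℕ → Set
HasIn m n v k =
  Σ (List (Vec ℕ n)) λ L → Unique L × (∀ u → (u ∈ L) ⇔ Covers m n v u) × (length L ≡ k)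

countLetter : ∀ {n} → ℕ → Vec ℕ n → ℕ
countLetter a [] = 0
countLetter a (x ∷ xs) with x ≟ a
... | Relation.Nullary.yes _ = suc (countLetter a xs)
... | Relation.Nullary.no _ = countLetter a xs

top : ∀ {n} → ℕ → Vec ℕ n → ℕ
top m [] = 0
top m (x ∷ xs) = countLetter (suc m) xs

suppSize : ∀ {n} → ℕ → Vec ℕ n → ℕ
suppSize m v = length (filter (λ s → VAny.any? (_≟ s) v) (map suc (upTo m)))

-- A word u below v is covered by v exactly when it is obtained by lowering a single
-- letter v_k: either a letter m+1 (lowered to min(m, v_1, …, v_{k-1})) or the last
-- occurrence of a letter s ∈ {1,…,m} (lowered to s-1).  In both cases the new letter
-- is min(v_k - 1, m, v_1, …, v_{k-1}), and the resulting word is the greatest word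
-- u ≤ v with u_k < v_k, which gives the cover property at once.  The lowerable
-- positions are counted by induction on the word: every letter m+1 after the first
-- position contributes to top(v), and every letter of Supp(v) contributes through its
-- last occurrence.
module Submission where

open import Defs
open import Data.Nat using (ℕ; zero; suc; _+_; _≤_; _<_; _⊓_; pred; z≤n; s≤s; s≤s⁻¹; s<s; s<s⁻¹; _≟_; _≤?_; _<?_)
open import Data.Nat.Properties
open import Data.Fin using (Fin; toℕ) renaming (zero to fzero; suc to fsuc)
import Data.Fin as Fin
import Data.Fin.Properties as Finₚ
open import Data.Vec using (Vec; []; _∷_; lookup; _[_]≔_; tabulate)
open import Data.Vec.Properties using (lookup∘update; lookup∘update′; tabulate∘lookup; tabulate-cong; ≡-dec)
open import Data.Vec.Relation.Unary.Any as VAny using (Any; index)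
open import Data.Vec.Relation.Unary.Any.Properties using (lookup-index)
open import Data.Vec.Membership.Propositional.Properties using (∈-lookup)
open import Data.List as List using (List; []; _∷_; length; filter; map; upTo; allFin)
open import Data.List.Properties using (filter-accept; filter-reject; filter-none; length-map)
open import Data.List.Membership.Propositional using (_∈_; _∉_)
open import Data.List.Membership.Propositional.Properties
  using (∈-map⁺; ∈-map⁻; ∈-upTo⁺; ∈-upTo⁻; ∈-filter⁺; ∈-filter⁻; ∈-allFin)
import Data.List.Relation.Unary.Any as ListAny
import Data.List.Relation.Unary.All as All
import Data.List.Relation.Unary.All.Properties as Allₚ
import Data.List.Relation.Unary.AllPairs as AllPairs
open import Data.List.Relation.Unary.Unique.Propositional using (Unique)
import Data.List.Relation.Unary.Unique.Propositional.Properties as Uniqueₚ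
open import Data.Product as Prod using (Σ; ∃; _×_; _,_)
open import Data.Sum using (_⊎_; inj₁; inj₂; [_,_])
open import Function using (_∘_; _⇔_; mk⇔; Equivalence)
open import Relation.Binary.PropositionalEquality using (_≡_; _≢_; refl; sym; trans; cong; cong₂; subst; module ≡-Reasoning)
open import Relation.Nullary using (¬_; Dec; yes; no; contradiction)
open import Relation.Nullary.Decidable using (_⊎-dec_; _×-dec_; _→-dec_; ¬?; map′)
open import Relation.Unary using (Decidable)

open Equivalence using (to; from)
open ≡-Reasoning

private
  variable
    m n : ℕ
    x : ℕ
    u v xs : Vec ℕ n

Unique-map⁺ : {A B : Set} {f : A → B} {xs : List A} →
              (∀ {x y} → x ∈ xs → y ∈ xs → f x ≡ f y → x ≡ y) →
              Unique xs → Unique (map f xs)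
Unique-map⁺ {xs = []} _ AllPairs.[] = AllPairs.[]
Unique-map⁺ {xs = x ∷ xs} inj (x∉xs AllPairs.∷ xs!) =
  Allₚ.map⁺ (All.tabulate λ y∈xs → All.lookup x∉xs y∈xs ∘ inj (ListAny.here refl) (ListAny.there y∈xs))
    AllPairs.∷ Unique-map⁺ (λ p q → inj (ListAny.there p) (ListAny.there q)) xs!

module _ {A B : Set} {P : A → Set} {Q : B → Set} (P? : Decidable P) (Q? : Decidable Q) where

  length-filter-tabulate : ∀ {n} {f : Fin n → A} {g : Fin n → B} → (∀ i → P (f i) ⇔ Q (g i)) →
                           length (filter P? (List.tabulate f)) ≡ length (filter Q? (List.tabulate g))
  length-filter-tabulate {zero} _ = refl
  length-filter-tabulate {suc n} {f} {g} P⇔Q with P? (f fzero) | Q? (g fzero)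
  ... | yes _  | yes _  = cong suc (length-filter-tabulate (P⇔Q ∘ fsuc))
  ... | no _   | no _   = length-filter-tabulate (P⇔Q ∘ fsuc)
  ... | yes p  | no ¬q  = contradiction (to (P⇔Q fzero) p) ¬q
  ... | no ¬p  | yes q  = contradiction (from (P⇔Q fzero) q) ¬p

module _ {A : Set} {P Q : A → Set} (P? : Decidable P) (Q? : Decidable Q) where

  filter-cong-∈ : ∀ {xs} → (∀ {y} → y ∈ xs → P y ⇔ Q y) → filter P? xs ≡ filter Q? xs
  filter-cong-∈ {[]} _ = refl
  filter-cong-∈ {y ∷ ys} P⇔Q with P? y
  ... | yes Py = begin
    y ∷ filter P? ys  ≡⟨ cong (y ∷_) (filter-cong-∈ (P⇔Q ∘ ListAny.there)) ⟩
    y ∷ filter Q? ys  ≡⟨ filter-accept Q? (to (P⇔Q (ListAny.here refl)) Py) ⟨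
    filter Q? (y ∷ ys) ∎
  ... | no ¬Py = begin
    filter P? ys       ≡⟨ filter-cong-∈ (P⇔Q ∘ ListAny.there) ⟩
    filter Q? ys       ≡⟨ filter-reject Q? (¬Py ∘ from (P⇔Q (ListAny.here refl))) ⟨
    filter Q? (y ∷ ys) ∎

module _ {A : Set} {P Q : A → Set} (P? : Decidable P) (Q? : Decidable Q)
         {x : A} (Q⇔ : ∀ y → Q y ⇔ (x ≡ y ⊎ P y)) where

  filter-insert-absorbed : ∀ {xs} → x ∉ xs ⊎ P x → filter Q? xs ≡ filter P? xs
  filter-insert-absorbed absorbed = filter-cong-∈ Q? P? λ y∈xs → mk⇔ (Q⇒P y∈xs absorbed) (from (Q⇔ _) ∘ inj₂)
    where
    Q⇒P : ∀ {y xs} → y ∈ xs → x ∉ xs ⊎ P x → Q y → P y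
    Q⇒P {y} y∈xs absorbed Qy with to (Q⇔ y) Qy | absorbed
    ... | inj₂ Py      | _          = Py
    ... | inj₁ refl    | inj₁ x∉xs  = contradiction y∈xs x∉xs
    ... | inj₁ refl    | inj₂ Px    = Px

  length-filter-insert : ∀ {xs} → Unique xs → x ∈ xs → ¬ P x →
                         length (filter Q? xs) ≡ suc (length (filter P? xs))
  length-filter-insert {_ ∷ ys} (x∉ys AllPairs.∷ _) (ListAny.here refl) ¬Px = begin
    length (filter Q? (x ∷ ys))       ≡⟨ cong length (filter-accept Q? (from (Q⇔ x) (inj₁ refl))) ⟩
    suc (length (filter Q? ys))       ≡⟨ cong (suc ∘ length) (filter-insert-absorbed (inj₁ λ x∈ys → All.lookup x∉ys x∈ys refl)) ⟩
    suc (length (filter P? ys))       ≡⟨ cong (suc ∘ length) (filter-reject P? ¬Px) ⟨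
    suc (length (filter P? (x ∷ ys))) ∎
  length-filter-insert {y ∷ ys} (y∉ys AllPairs.∷ ys!) (ListAny.there x∈ys) ¬Px with P? y
  ... | yes Py = begin
    length (filter Q? (y ∷ ys))       ≡⟨ cong length (filter-accept Q? (from (Q⇔ y) (inj₂ Py))) ⟩
    suc (length (filter Q? ys))       ≡⟨ cong suc (length-filter-insert ys! x∈ys ¬Px) ⟩
    suc (suc (length (filter P? ys))) ∎
  ... | no ¬Py = begin
    length (filter Q? (y ∷ ys))       ≡⟨ cong length (filter-reject Q? ¬Qy) ⟩
    length (filter Q? ys)             ≡⟨ length-filter-insert ys! x∈ys ¬Px ⟩
    suc (length (filter P? ys))       ∎
    where
    ¬Qy : ¬ Q y
    ¬Qy Qy = [ (λ x≡y → All.lookup y∉ys x∈ys (sym x≡y)) , ¬Py ] (to (Q⇔ y) Qy)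

≗⇒≡ : (∀ i → lookup u i ≡ lookup v i) → u ≡ v
≗⇒≡ {u = u} {v = v} eq = begin
  u                ≡⟨ tabulate∘lookup u ⟨
  tabulate (lookup u) ≡⟨ tabulate-cong eq ⟩
  tabulate (lookup v) ≡⟨ tabulate∘lookup v ⟩
  v                ∎

≤W-antisym : u ≤W v → v ≤W u → u ≡ v
≤W-antisym u≤v v≤u = ≗⇒≡ λ i → ≤-antisym (u≤v i) (v≤u i)

<W⇒∃< : ∀ {n} {u v : Vec ℕ n} → u <W v → ∃ λ i → lookup u i < lookup v i
<W⇒∃< {n = n} {u = u} {v = v} (u≤v , u≢v)
  with i , uᵢ≢vᵢ ← Finₚ.¬∀⟶∃¬ n _ (λ i → lookup u i ≟ lookup v i) (u≢v ∘ ≗⇒≡)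
  = i , ≤∧≢⇒< (u≤v i) uᵢ≢vᵢ

LastOccurrence : Vec ℕ n → Fin n → Set
LastOccurrence v k = ∀ j → toℕ k < toℕ j → lookup v j ≢ lookup v k

data Lowerable (m : ℕ) (v : Vec ℕ n) (k : Fin n) : Set where
  topLetter    : lookup v k ≡ suc m → Lowerable m v k
  lastOfLetter : 1 ≤ lookup v k → lookup v k ≤ m → LastOccurrence v k → Lowerable m v k

lastOccurrence? : (v : Vec ℕ n) → Decidable (LastOccurrence v)
lastOccurrence? v k = Finₚ.all? λ j → toℕ k <? toℕ j →-dec ¬? (lookup v j ≟ lookup v k)

lowerable? : (m : ℕ) (v : Vec ℕ n) → Decidable (Lowerable m v)
lowerable? m v k =
  map′ [ topLetter , (λ (1≤ , ≤m , last) → lastOfLetter 1≤ ≤m last) ] fromLowerable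
       (lookup v k ≟ suc m ⊎-dec 1 ≤? lookup v k ×-dec lookup v k ≤? m ×-dec lastOccurrence? v k)
  where
  fromLowerable : Lowerable m v k → _
  fromLowerable (topLetter top) = inj₁ top
  fromLowerable (lastOfLetter 1≤ ≤m last) = inj₂ (1≤ , ≤m , last)

lowerable⇒1≤ : ∀ {k : Fin n} → Lowerable m v k → 1 ≤ lookup v k
lowerable⇒1≤ (topLetter top) = subst (1 ≤_) (sym top) (s≤s z≤n)
lowerable⇒1≤ (lastOfLetter 1≤ _ _) = 1≤

lastOccurrence-suc⁺ : ∀ {k} → LastOccurrence xs k → LastOccurrence (x ∷ xs) (fsuc k)
lastOccurrence-suc⁺ last (fsuc j) k<j = last j (s<s⁻¹ k<j)

lastOccurrence-suc⁻ : ∀ {k} → LastOccurrence (x ∷ xs) (fsuc k) → LastOccurrence xs k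
lastOccurrence-suc⁻ last j k<j = last (fsuc j) (s<s k<j)

lastOccurrence-zero⁺ : ¬ Any (_≡ x) xs → LastOccurrence (x ∷ xs) fzero
lastOccurrence-zero⁺ {xs = xs} x∉xs (fsuc j) _ xsⱼ≡x =
  x∉xs (VAny.map (λ xsⱼ≡y → trans (sym xsⱼ≡y) xsⱼ≡x) (∈-lookup j xs))

lastOccurrence-zero⁻ : LastOccurrence (x ∷ xs) fzero → ¬ Any (_≡ x) xs
lastOccurrence-zero⁻ last x∈xs = last (fsuc (index x∈xs)) (s≤s z≤n) (lookup-index x∈xs)

lowerable-suc⇔ : ∀ {k} → Lowerable m (x ∷ xs) (fsuc k) ⇔ Lowerable m xs k
lowerable-suc⇔ = mk⇔
  (λ { (topLetter top) → topLetter top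
     ; (lastOfLetter 1≤ ≤m last) → lastOfLetter 1≤ ≤m (lastOccurrence-suc⁻ last) })
  (λ { (topLetter top) → topLetter top
     ; (lastOfLetter 1≤ ≤m last) → lastOfLetter 1≤ ≤m (lastOccurrence-suc⁺ last) })

lastOccurrence : (v : Vec ℕ n) (i : Fin n) →
                 ∃ λ k → toℕ i ≤ toℕ k × lookup v k ≡ lookup v i × LastOccurrence v k
lastOccurrence (x ∷ xs) (fsuc i) with k , i≤k , same , last ← lastOccurrence xs i =
  fsuc k , s≤s i≤k , same , lastOccurrence-suc⁺ last
lastOccurrence (x ∷ xs) fzero with VAny.any? (_≟ x) xs
... | yes x∈xs with k , _ , same , last ← lastOccurrence xs (index x∈xs) =
  fsuc k , z≤n , trans same (lookup-index x∈xs) , lastOccurrence-suc⁺ last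
... | no x∉xs = fzero , z≤n , refl , lastOccurrence-zero⁺ x∉xs

prefixMin : ℕ → Vec ℕ n → Fin n → ℕ
prefixMin m (x ∷ xs) fzero    = m
prefixMin m (x ∷ xs) (fsuc i) = x ⊓ prefixMin m xs i

prefixMin≤lookup : ∀ m (v : Vec ℕ n) {j k} → toℕ j < toℕ k → prefixMin m v k ≤ lookup v j
prefixMin≤lookup m (x ∷ xs) {fzero}  {fsuc k} _   = m⊓n≤m x _
prefixMin≤lookup m (x ∷ xs) {fsuc j} {fsuc k} j<k = ≤-trans (m⊓n≤n x _) (prefixMin≤lookup m xs (s<s⁻¹ j<k))

prefixMin-greatest : ∀ m (v : Vec ℕ n) k {y} → y ≤ m → (∀ j → toℕ j < toℕ k → y ≤ lookup v j) →
                     y ≤ prefixMin m v k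
prefixMin-greatest m (x ∷ xs) fzero    y≤m _     = y≤m
prefixMin-greatest m (x ∷ xs) (fsuc k) y≤m y≤pre =
  ⊓-glb (y≤pre fzero (s≤s z≤n)) (prefixMin-greatest m xs k y≤m λ j j<k → y≤pre (fsuc j) (s<s j<k))

-- At the last occurrence of a letter s ≤ m of a word this is s - 1, since MN2
-- makes s a lower bound of the earlier letters.
lowered : ℕ → Vec ℕ n → Fin n → ℕ
lowered m v k = pred (lookup v k) ⊓ prefixMin m v k

lower : ℕ → Vec ℕ n → Fin n → Vec ℕ n
lower m v k = v [ k ]≔ lowered m v k

pred[m]⊓n<m : ∀ {m} n → 1 ≤ m → pred m ⊓ n < m
pred[m]⊓n<m {suc m} n _ = s≤s (m⊓n≤m m n)

lowered<lookup : ∀ m (v : Vec ℕ n) k → 1 ≤ lookup v k → lowered m v k < lookup v k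
lowered<lookup m v k = pred[m]⊓n<m (prefixMin m v k)

later<lowerable : ∀ {k} a → IsWord m n v → Lowerable m v k → toℕ k < toℕ a →
                   1 ≤ lookup v a → lookup v a ≤ m → lookup v a < lookup v k
later<lowerable a _  (topLetter top) _ _ vₐ≤m = subst (_ <_) (sym top) (s≤s vₐ≤m)
later<lowerable a wv (lastOfLetter _ _ last) k<a 1≤vₐ vₐ≤m =
  ≤∧≢⇒< (IsWord.mn2 wv a _ k<a 1≤vₐ vₐ≤m) (last a k<a)

later≤lowered : ∀ {k} a → IsWord m n v → Lowerable m v k → toℕ k < toℕ a →
                 1 ≤ lookup v a → lookup v a ≤ m → lookup v a ≤ lowered m v k
later≤lowered {v = v} {k = k} a wv lk k<a 1≤vₐ vₐ≤m =
  ⊓-glb (<⇒≤pred (later<lowerable a wv lk k<a 1≤vₐ vₐ≤m))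
        (prefixMin-greatest _ v k vₐ≤m λ j j<k → IsWord.mn2 wv a j (<-trans j<k k<a) 1≤vₐ vₐ≤m)

letter≤prefixMin : ∀ (v : Vec ℕ n) k → IsWord m n u → u ≤W v → lookup u k ≤ m →
                   lookup u k ≤ prefixMin m v k
letter≤prefixMin {u = u} v k wu u≤v uₖ≤m with lookup u k | IsWord.mn2 wu k
... | zero  | _    = z≤n
... | suc _ | mn2ₖ = prefixMin-greatest _ v k uₖ≤m λ j j<k → ≤-trans (mn2ₖ j j<k (s≤s z≤n) uₖ≤m) (u≤v j)

lower-isWord : ∀ {k} → IsWord m n v → Lowerable m v k → IsWord m n (lower m v k)
lower-isWord {m = m} {v = v} {k = k} wv lk = record { alphabet = alphabet ; mn1 = mn1 ; mn2 = mn2 }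
  where
  L = lowered m v k

  L<top : L < suc m
  L<top = <-≤-trans (lowered<lookup m v k (lowerable⇒1≤ lk)) (IsWord.alphabet wv k)

  alphabet : ∀ i → lookup (lower m v k) i ≤ suc m
  alphabet i with i Fin.≟ k
  ... | yes refl rewrite lookup∘update k v L = <⇒≤ L<top
  ... | no i≢k   rewrite lookup∘update′ i≢k v L = IsWord.alphabet wv i

  mn1 : ∀ i → toℕ i ≡ 0 → lookup (lower m v k) i ≢ suc m
  mn1 i i≡0 with i Fin.≟ k
  ... | yes refl rewrite lookup∘update k v L = <⇒≢ L<top
  ... | no i≢k   rewrite lookup∘update′ i≢k v L = IsWord.mn1 wv i i≡0

  mn2 : ∀ a b → toℕ b < toℕ a → 1 ≤ lookup (lower m v k) a → lookup (lower m v k) a ≤ m →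
        lookup (lower m v k) a ≤ lookup (lower m v k) b
  mn2 a b b<a 1≤ ≤m with a Fin.≟ k | b Fin.≟ k
  ... | yes refl | yes refl = contradiction b<a (<-irrefl refl)
  ... | yes refl | no b≢k   rewrite lookup∘update k v L | lookup∘update′ b≢k v L =
    ≤-trans (m⊓n≤n _ _) (prefixMin≤lookup m v b<a)
  ... | no a≢k   | yes refl rewrite lookup∘update k v L | lookup∘update′ a≢k v L =
    later≤lowered a wv lk b<a 1≤ ≤m
  ... | no a≢k   | no b≢k   rewrite lookup∘update′ a≢k v L | lookup∘update′ b≢k v L =
    IsWord.mn2 wv a b b<a 1≤ ≤m

lower<W : ∀ m (v : Vec ℕ n) k → 1 ≤ lookup v k → lower m v k <W v
lower<W m v k 1≤vₖ = lower≤v , lower≢v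
  where
  L<vₖ = lowered<lookup m v k 1≤vₖ

  lower≤v : lower m v k ≤W v
  lower≤v i with i Fin.≟ k
  ... | yes refl rewrite lookup∘update k v (lowered m v k) = <⇒≤ L<vₖ
  ... | no i≢k   rewrite lookup∘update′ i≢k v (lowered m v k) = ≤-refl

  lower≢v : lower m v k ≢ v
  lower≢v eq = <⇒≢ L<vₖ (trans (sym (lookup∘update k v _)) (cong (λ w → lookup w k) eq))

lower-greatest : ∀ {m n} {u v : Vec ℕ n} k → IsWord m n u → IsWord m n v → u ≤W v →
                 lookup u k < lookup v k → u ≤W lower m v k
lower-greatest {m} {u = u} {v} k wu wv u≤v uₖ<vₖ i with i Fin.≟ k
... | yes refl rewrite lookup∘update k v (lowered m v k) =
  ⊓-glb (<⇒≤pred uₖ<vₖ) (letter≤prefixMin v k wu u≤v (s≤s⁻¹ (<-≤-trans uₖ<vₖ (IsWord.alphabet wv k))))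
... | no i≢k   rewrite lookup∘update′ i≢k v (lowered m v k) = u≤v i

lower-injective : ∀ {a b} → Lowerable m v a → lower m v a ≡ lower m v b → a ≡ b
lower-injective {m = m} {v = v} {a} {b} la eq with a Fin.≟ b
... | yes a≡b = a≡b
... | no a≢b  = contradiction lowered≡lookup (<⇒≢ (lowered<lookup m v a (lowerable⇒1≤ la)))
  where
  lowered≡lookup : lowered m v a ≡ lookup v a
  lowered≡lookup = begin
    lowered m v a          ≡⟨ lookup∘update a v _ ⟨
    lookup (lower m v a) a ≡⟨ cong (λ w → lookup w a) eq ⟩
    lookup (lower m v b) a ≡⟨ lookup∘update′ a≢b v _ ⟩
    lookup v a             ∎

lowerable-below : ∀ i → IsWord m n u → IsWord m n v → u ≤W v → lookup u i < lookup v i →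
                  ∃ λ k → Lowerable m v k × lookup u k < lookup v k
lowerable-below {m = m} {u = u} {v = v} i wu wv u≤v uᵢ<vᵢ with lookup v i ≟ suc m
... | yes top = i , topLetter top , uᵢ<vᵢ
... | no vᵢ≢top with k , i≤k , vₖ≡vᵢ , last ← lastOccurrence v i =
  k , lastOfLetter 1≤vₖ vₖ≤m last , uₖ<vₖ
  where
  1≤vₖ : 1 ≤ lookup v k
  1≤vₖ = subst (1 ≤_) (sym vₖ≡vᵢ) (≤-<-trans z≤n uᵢ<vᵢ)

  vₖ≤m : lookup v k ≤ m
  vₖ≤m = subst (_≤ m) (sym vₖ≡vᵢ) (s≤s⁻¹ (≤∧≢⇒< (IsWord.alphabet wv i) vᵢ≢top))

  -- If u kept the letter v_k, MN2 for u would force u_i ≥ v_k = v_i.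
  vᵢ≤uᵢ : lookup u k ≡ lookup v k → lookup v i ≤ lookup u i
  vᵢ≤uᵢ uₖ≡vₖ with m≤n⇒m<n∨m≡n i≤k
  ... | inj₁ i<k = subst (_≤ lookup u i) (trans uₖ≡vₖ vₖ≡vᵢ)
    (IsWord.mn2 wu k i i<k (subst (1 ≤_) (sym uₖ≡vₖ) 1≤vₖ) (subst (_≤ m) (sym uₖ≡vₖ) vₖ≤m))
  ... | inj₂ i≡k = subst (λ j → lookup v j ≤ lookup u j) (sym (Finₚ.toℕ-injective i≡k))
    (≤-reflexive (sym uₖ≡vₖ))

  uₖ<vₖ : lookup u k < lookup v k
  uₖ<vₖ with m≤n⇒m<n∨m≡n (u≤v k)
  ... | inj₁ uₖ<vₖ = uₖ<vₖ
  ... | inj₂ uₖ≡vₖ = contradiction (vᵢ≤uᵢ uₖ≡vₖ) (<⇒≱ uᵢ<vᵢ)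

lower-covered : ∀ {k} → IsWord m n v → Lowerable m v k → Covers m n v (lower m v k)
lower-covered {m = m} {n = n} {v = v} {k} wv lk =
  lower-isWord wv lk , wv , lower<W m v k (lowerable⇒1≤ lk) , nothing-between
  where
  nothing-between : ¬ Σ (Vec ℕ n) λ u → IsWord m n u × (lower m v k <W u) × (u <W v)
  nothing-between (u , wu , (lower≤u , lower≢u) , u<v@(u≤v , _))
    with i , uᵢ<vᵢ ← <W⇒∃< u<v
    with i Fin.≟ k
  ... | yes refl = lower≢u (≤W-antisym lower≤u (lower-greatest i wu wv u≤v uᵢ<vᵢ))
  ... | no i≢k   = <⇒≱ uᵢ<vᵢ (subst (_≤ lookup u i) (lookup∘update′ i≢k v _) (lower≤u i))

covered⇒lower : Covers m n v u → ∃ λ k → Lowerable m v k × u ≡ lower m v k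
covered⇒lower {m = m} {v = v} {u = u} (wu , wv , u<v@(u≤v , _) , nothing-between)
  with i , uᵢ<vᵢ ← <W⇒∃< u<v
  with k , lk , uₖ<vₖ ← lowerable-below i wu wv u≤v uᵢ<vᵢ
  with ≡-dec _≟_ u (lower m v k)
... | yes u≡lower = k , lk , u≡lower
... | no u≢lower  = contradiction
  (lower m v k , lower-isWord wv lk , (lower-greatest k wu wv u≤v uₖ<vₖ , u≢lower) ,
   lower<W m v k (lowerable⇒1≤ lk))
  nothing-between

lowerablePositions : (m : ℕ) (v : Vec ℕ n) → List (Fin n)
lowerablePositions m v = filter (lowerable? m v) (allFin _)

length-lowerablePositions-tail : ∀ m x (xs : Vec ℕ n) →
  length (filter (lowerable? m (x ∷ xs)) (List.tabulate fsuc)) ≡ length (lowerablePositions m xs)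
length-lowerablePositions-tail m x xs =
  length-filter-tabulate (lowerable? m (x ∷ xs)) (lowerable? m xs) {g = λ k → k} (λ _ → lowerable-suc⇔)

length-lowerablePositions-accept : Lowerable m (x ∷ xs) fzero →
  length (lowerablePositions m (x ∷ xs)) ≡ suc (length (lowerablePositions m xs))
length-lowerablePositions-accept {m = m} {x = x} {xs = xs} l₀ =
  trans (cong length (filter-accept (lowerable? m (x ∷ xs)) l₀))
        (cong suc (length-lowerablePositions-tail m x xs))

length-lowerablePositions-reject : ¬ Lowerable m (x ∷ xs) fzero →
  length (lowerablePositions m (x ∷ xs)) ≡ length (lowerablePositions m xs)
length-lowerablePositions-reject {m = m} {x = x} {xs = xs} ¬l₀ =
  trans (cong length (filter-reject (lowerable? m (x ∷ xs)) ¬l₀))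
        (length-lowerablePositions-tail m x xs)

countLetter-≡ : ∀ {a} (xs : Vec ℕ n) → x ≡ a → countLetter a (x ∷ xs) ≡ suc (countLetter a xs)
countLetter-≡ {x = x} {a = a} xs x≡a with x ≟ a
... | yes _   = refl
... | no x≢a  = contradiction x≡a x≢a

countLetter-≢ : ∀ {a} (xs : Vec ℕ n) → x ≢ a → countLetter a (x ∷ xs) ≡ countLetter a xs
countLetter-≢ {x = x} {a = a} xs x≢a with x ≟ a
... | yes x≡a = contradiction x≡a x≢a
... | no _    = refl

letters-unique : ∀ m → Unique (map suc (upTo m))
letters-unique m = Uniqueₚ.map⁺ suc-injective (Uniqueₚ.upTo⁺ m)

∈-letters : 1 ≤ x → x ≤ m → x ∈ map suc (upTo m)
∈-letters {x = suc x} _ x<m = ∈-map⁺ suc (∈-upTo⁺ x<m)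

∉-letters : x ≡ 0 ⊎ x ≡ suc m → x ∉ map suc (upTo m)
∉-letters x≡0∨top x∈ with i , i<m , refl ← ∈-map⁻ suc x∈ with x≡0∨top
... | inj₂ top = <-irrefl (suc-injective top) (∈-upTo⁻ i<m)

occurs-∷⇔ : ∀ {s} → Any (_≡ s) (x ∷ xs) ⇔ (x ≡ s ⊎ Any (_≡ s) xs)
occurs-∷⇔ = mk⇔ VAny.toSum VAny.fromSum

suppSize-[] : ∀ m → suppSize m [] ≡ 0
suppSize-[] m = cong length (filter-none (λ s → VAny.any? (_≟ s) []) {map suc (upTo m)} (All.tabulate λ _ ()))

suppSize-∷-fresh : 1 ≤ x → x ≤ m → ¬ Any (_≡ x) xs → suppSize m (x ∷ xs) ≡ suc (suppSize m xs)
suppSize-∷-fresh {m = m} 1≤x x≤m x∉xs =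
  length-filter-insert _ _ (λ _ → occurs-∷⇔) (letters-unique m) (∈-letters 1≤x x≤m) x∉xs

suppSize-∷-stale : ∀ m (xs : Vec ℕ n) → x ∉ map suc (upTo m) ⊎ Any (_≡ x) xs → suppSize m (x ∷ xs) ≡ suppSize m xs
suppSize-∷-stale m xs stale = cong length (filter-insert-absorbed _ _ (λ _ → occurs-∷⇔) stale)

length-lowerablePositions : ∀ m (v : Vec ℕ n) → (∀ i → lookup v i ≤ suc m) →
                 length (lowerablePositions m v) ≡ countLetter (suc m) v + suppSize m v
length-lowerablePositions m [] _ = sym (suppSize-[] m)
length-lowerablePositions m (zero ∷ xs) bound = begin
  length (lowerablePositions m (0 ∷ xs))             ≡⟨ length-lowerablePositions-reject not-lowerable ⟩
  length (lowerablePositions m xs)                   ≡⟨ length-lowerablePositions m xs (bound ∘ fsuc) ⟩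
  countLetter (suc m) xs + suppSize m xs             ≡⟨ cong₂ _+_ (countLetter-≢ {x = 0} xs λ ()) (suppSize-∷-stale m xs (inj₁ (∉-letters (inj₁ refl)))) ⟨
  countLetter (suc m) (0 ∷ xs) + suppSize m (0 ∷ xs) ∎
  where
  not-lowerable : ¬ Lowerable m (0 ∷ xs) fzero
  not-lowerable (lastOfLetter () _ _)
length-lowerablePositions m (suc y ∷ xs) bound = by-head-letter (suc y ≟ suc m) (VAny.any? (_≟ suc y) xs)
  where
  ih : length (lowerablePositions m xs) ≡ countLetter (suc m) xs + suppSize m xs
  ih = length-lowerablePositions m xs (bound ∘ fsuc)

  by-head-letter : Dec (suc y ≡ suc m) → Dec (Any (_≡ suc y) xs) →
    length (lowerablePositions m (suc y ∷ xs)) ≡ countLetter (suc m) (suc y ∷ xs) + suppSize m (suc y ∷ xs)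
  by-head-letter (yes x≡top) _ = begin
    length (lowerablePositions m (suc y ∷ xs))                 ≡⟨ length-lowerablePositions-accept (topLetter x≡top) ⟩
    suc (length (lowerablePositions m xs))                     ≡⟨ cong suc ih ⟩
    suc (countLetter (suc m) xs + suppSize m xs)               ≡⟨ cong₂ _+_ (countLetter-≡ xs x≡top) (suppSize-∷-stale m xs (inj₁ (∉-letters (inj₂ x≡top)))) ⟨
    countLetter (suc m) (suc y ∷ xs) + suppSize m (suc y ∷ xs) ∎
  by-head-letter (no x≢top) (yes x∈xs) = begin
    length (lowerablePositions m (suc y ∷ xs))                 ≡⟨ length-lowerablePositions-reject not-lowerable ⟩
    length (lowerablePositions m xs)                           ≡⟨ ih ⟩
    countLetter (suc m) xs + suppSize m xs                     ≡⟨ cong₂ _+_ (countLetter-≢ xs x≢top) (suppSize-∷-stale m xs (inj₂ x∈xs)) ⟨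
    countLetter (suc m) (suc y ∷ xs) + suppSize m (suc y ∷ xs) ∎
    where
    not-lowerable : ¬ Lowerable m (suc y ∷ xs) fzero
    not-lowerable (topLetter top)         = x≢top top
    not-lowerable (lastOfLetter _ _ last) = lastOccurrence-zero⁻ last x∈xs
  by-head-letter (no x≢top) (no x∉xs) = begin
    length (lowerablePositions m (suc y ∷ xs))                 ≡⟨ length-lowerablePositions-accept (lastOfLetter (s≤s z≤n) x≤m (lastOccurrence-zero⁺ x∉xs)) ⟩
    suc (length (lowerablePositions m xs))                     ≡⟨ cong suc ih ⟩
    suc (countLetter (suc m) xs + suppSize m xs)               ≡⟨ +-suc _ _ ⟨
    countLetter (suc m) xs + suc (suppSize m xs)               ≡⟨ cong₂ _+_ (countLetter-≢ xs x≢top) (suppSize-∷-fresh (s≤s z≤n) x≤m x∉xs) ⟨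
    countLetter (suc m) (suc y ∷ xs) + suppSize m (suc y ∷ xs) ∎
    where
    x≤m : suc y ≤ m
    x≤m = s≤s⁻¹ (≤∧≢⇒< (bound fzero) x≢top)

top≡countLetter : IsWord m n v → top m v ≡ countLetter (suc m) v
top≡countLetter {v = []}     _  = refl
top≡countLetter {v = x ∷ xs} wv = sym (countLetter-≢ xs (IsWord.mn1 wv fzero refl))

lowerCovers : (m : ℕ) (v : Vec ℕ n) → List (Vec ℕ n)
lowerCovers m v = map (lower m v) (lowerablePositions m v)

lowerCovers-unique : ∀ m (v : Vec ℕ n) → Unique (lowerCovers m v)
lowerCovers-unique {n} m v = Unique-map⁺
  (λ a∈ _ → lower-injective (Prod.proj₂ (∈-filter⁻ (lowerable? m v) {xs = allFin n} a∈)))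
  (Uniqueₚ.filter⁺ (lowerable? m v) {allFin n} (Uniqueₚ.allFin⁺ n))

∈-lowerCovers⇔ : IsWord m n v → u ∈ lowerCovers m v ⇔ Covers m n v u
∈-lowerCovers⇔ {m = m} {v = v} wv = mk⇔ ∈⇒covered covered⇒∈
  where
  ∈⇒covered : ∀ {u} → u ∈ lowerCovers m v → Covers m _ v u
  ∈⇒covered u∈ with k , k∈ , refl ← ∈-map⁻ (lower m v) u∈ =
    lower-covered wv (Prod.proj₂ (∈-filter⁻ (lowerable? m v) {xs = allFin _} k∈))
  covered⇒∈ : ∀ {u} → Covers m _ v u → u ∈ lowerCovers m v
  covered⇒∈ cover with k , lk , refl ← covered⇒lower cover =
    ∈-map⁺ (lower m v) (∈-filter⁺ (lowerable? m v) (∈-allFin k) lk)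

lemma5p3 : (m n : ℕ) (v : Vec ℕ n) → IsWord m n v →
           HasIn m n v (top m v + suppSize m v)
lemma5p3 m n v wv = lowerCovers m v , lowerCovers-unique m v , (λ _ → ∈-lowerCovers⇔ wv) , count
  where
  count : length (lowerCovers m v) ≡ top m v + suppSize m v
  count = begin
    length (lowerCovers m v)             ≡⟨ length-map (lower m v) (lowerablePositions m v) ⟩
    length (lowerablePositions m v)      ≡⟨ length-lowerablePositions m v (IsWord.alphabet wv) ⟩
    countLetter (suc m) v + suppSize m v ≡⟨ cong (_+ suppSize m v) (top≡countLetter wv) ⟨
    top m v + suppSize m v               ∎
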